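{- Let $d=(d_1,\dots,d_n)$ be a degree sequence with $d_1\ge\dots\ge d_n$. For all $k\in[n]$ with $k>m(d)$, we have $\Delta_k(d)\ge 2$.
   Context: $m(\pi)=\max\{i:\pi_i\ge i-1\}$ for an integer sequence $\pi$. For $k\in[n]$, $\Delta_k(\pi)=k(k-1)+\sum_{\ell>k}\min\{k,\pi_\ell\}-\sum_{\ell\le k}\pi_\ell$ (the $k$th Erdős–Gallai difference). -}

module Defs where

open import Data.Nat using (ℕ; zero; suc; _+_; _*_; _∸_; _≤_; _<_; _⊔_; _⊓_; _≤ᵇ_; _<ᵇ_)
open import Data.Integer as ℤ using (ℤ; +_; _-_)
open import Data.Fin using (Fin; toℕ)
open import Data.List using (List; map; foldr; allFin)
open import Data.Nat.ListAction using (sum)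
open import Data.Bool using (Bool; true; false; if_then_else_)
open import Data.Product using (Σ; _×_)
open import Relation.Binary.PropositionalEquality using (_≡_)

finSum : (n : ℕ) → (Fin n → ℕ) → ℕ
finSum n f = sum (map f (allFin n))

record SimpleGraph (n : ℕ) : Set where
  field
    adj   : Fin n → Fin n → Bool
    sym   : ∀ i j → adj i j ≡ adj j i
    irrefl : ∀ i → adj i i ≡ false

degree : {n : ℕ} → SimpleGraph n → Fin n → ℕ
degree {n} G i = finSum n (λ j → if SimpleGraph.adj G i j then 1 else 0)

IsDegreeSequence : (n : ℕ) → (Fin n → ℕ) → Set
IsDegreeSequence n d = Σ (SimpleGraph n) (λ G → ∀ j → degree G j ≡ d j)

NonIncreasing : (n : ℕ) → (Fin n → ℕ) → Set
NonIncreasing n d = ∀ i j → toℕ i ≤ toℕ j → d j ≤ d i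

-- Indices: the paper's index i ∈ [n] corresponds to j : Fin n with i = toℕ j + 1.
-- m(d) = max { i : d_i ≥ i - 1 }  (max of empty set taken as 0; only arises for n = 0)
mOf : (n : ℕ) → (Fin n → ℕ) → ℕ
mOf n d = foldr _⊔_ 0 (map (λ j → if toℕ j ≤ᵇ d j then suc (toℕ j) else 0) (allFin n))

Δ : (n : ℕ) → (Fin n → ℕ) → ℕ → ℤ
Δ n d k =
  (+ (k * (k ∸ 1)))
  ℤ.+ (+ finSum n (λ j → if k ≤ᵇ toℕ j then k ⊓ d j else 0))
  - (+ finSum n (λ j → if toℕ j <ᵇ k then d j else 0))

module Submission where

open import Defs
open import Data.Nat using (ℕ; _≤_; _<_)
open import Data.Integer using (+_) renaming (_≤_ to _≤ℤ_)
open import Data.Fin using (Fin)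

open import Data.Nat using (zero; suc; _+_; _*_; _∸_; _⊔_; _⊓_; _≤ᵇ_; _<ᵇ_; _<?_; z≤n; s≤s)
open import Data.Nat.Properties
open import Data.Nat.Tactic.RingSolver using (solve-∀)
open import Data.Fin using (toℕ; fromℕ<)
open import Data.Fin.Properties using (toℕ-fromℕ<)
import Data.Fin as Fin
open import Data.Nat.ListAction using (sum)
open import Data.List using (foldr; tabulate)
open import Data.List.Properties using (map-tabulate)
open import Data.Bool using (Bool; true; false; not; if_then_else_; T)
open import Data.Empty using (⊥-elim)
open import Data.Product using (_,_)
open import Data.Sum using (inj₁; inj₂)
open import Function using (_∘_; id)
open import Relation.Nullary using (¬_; yes; no)
open import Relation.Binary.PropositionalEquality
import Data.Integer as ℤ
import Data.Integer.Properties as ℤ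

-- Number the vertices 0, …, n-1, let k = q + 1 and S = {0, …, q}.
-- The degree sum over S counts every edge inside S twice and every edge from S
-- to its complement once:  Σ_{j∈S} d_j = 2e(S) + e(S, S̄).  A vertex i ∉ S has at
-- most min(k, d_i) neighbours in S, so e(S, S̄) ≤ Σ_{i≥k} min(k, d_i).  Building
-- S one vertex at a time, vertex p adds twice its number of earlier neighbours,
-- at most 2p; this gives 2e({0,…,q-1}) ≤ q(q-1).  Since k > m(d), the last
-- vertex q has d_q < q, so it adds at most 2(q-1), and 2e(S) ≤ k(k-1) - 2.
-- Hence Δ_k(d) ≥ 2.

sumBelow : ℕ → (ℕ → ℕ) → ℕ
sumBelow zero    f = 0
sumBelow (suc n) f = sumBelow n f + f n

syntax sumBelow n (λ i → e) = ∑[ i < n ] e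

sum-cong : ∀ n {f g : ℕ → ℕ} → (∀ i → i < n → f i ≡ g i) → sumBelow n f ≡ sumBelow n g
sum-cong zero    eq = refl
sum-cong (suc n) eq = cong₂ _+_ (sum-cong n (λ i i<n → eq i (m≤n⇒m≤1+n i<n))) (eq n ≤-refl)

sum-mono : ∀ n {f g : ℕ → ℕ} → (∀ i → i < n → f i ≤ g i) → sumBelow n f ≤ sumBelow n g
sum-mono zero    le = z≤n
sum-mono (suc n) le = +-mono-≤ (sum-mono n (λ i i<n → le i (m≤n⇒m≤1+n i<n))) (le n ≤-refl)

sum-range-mono : ∀ {m n} (f : ℕ → ℕ) → m ≤ n → sumBelow m f ≤ sumBelow n f
sum-range-mono {m} {zero}  f z≤n = z≤n
sum-range-mono {m} {suc n} f m≤1+n with m≤n⇒m<n∨m≡n m≤1+n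
... | inj₁ (s≤s m≤n) = ≤-trans (sum-range-mono f m≤n) (m≤m+n _ _)
... | inj₂ refl      = ≤-refl

sum-+ : ∀ n (f g : ℕ → ℕ) → ∑[ i < n ] (f i + g i) ≡ sumBelow n f + sumBelow n g
sum-+ zero    f g = refl
sum-+ (suc n) f g = begin
  ∑[ i < n ] (f i + g i) + (f n + g n)            ≡⟨ cong (_+ (f n + g n)) (sum-+ n f g) ⟩
  sumBelow n f + sumBelow n g + (f n + g n)      ≡⟨ interchange (sumBelow n f) _ _ _ ⟩
  sumBelow n f + f n + (sumBelow n g + g n)      ∎
  where
  open ≡-Reasoning
  interchange : ∀ a b c d → a + b + (c + d) ≡ a + c + (b + d)
  interchange = solve-∀

sum-const : ∀ n c → ∑[ i < n ] c ≡ n * c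
sum-const zero    c = refl
sum-const (suc n) c = trans (cong (_+ c) (sum-const n c)) (+-comm (n * c) c)

sum-shift : ∀ n (f : ℕ → ℕ) → sumBelow (suc n) f ≡ f 0 + ∑[ i < n ] f (suc i)
sum-shift zero    f = +-comm 0 (f 0)
sum-shift (suc n) f = trans (cong (_+ f (suc n)) (sum-shift n f)) (+-assoc (f 0) _ _)

sum-swap : ∀ m n (h : ℕ → ℕ → ℕ) → ∑[ j < m ] ∑[ i < n ] h j i ≡ ∑[ i < n ] ∑[ j < m ] h j i
sum-swap zero    n h = sym (trans (sum-const n 0) (*-zeroʳ n))
sum-swap (suc m) n h = trans (cong (_+ ∑[ i < n ] h m i) (sum-swap m n h))
                             (sym (sum-+ n (λ i → ∑[ j < m ] h j i) (λ i → h m i)))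

if-true : ∀ {b : Bool} {x y : ℕ} → T b → (if b then x else y) ≡ x
if-true {true} _ = refl

if-false : ∀ {b : Bool} {x y : ℕ} → ¬ T b → (if b then x else y) ≡ y
if-false {true}  ¬b = ⊥-elim (¬b _)
if-false {false} _  = refl

if-≤ : ∀ (b : Bool) {x y : ℕ} → x ≤ y → (if b then x else 0) ≤ (if b then y else 0)
if-≤ true  x≤y = x≤y
if-≤ false _   = z≤n

sum-if : ∀ n (b : Bool) (f : ℕ → ℕ) → ∑[ i < n ] (if b then f i else 0) ≡ (if b then sumBelow n f else 0)
sum-if n true  f = refl
sum-if n false f = trans (sum-const n 0) (*-zeroʳ n)

≤ᵇ≡not<ᵇ : ∀ k i → (k ≤ᵇ i) ≡ not (i <ᵇ k)
≤ᵇ≡not<ᵇ zero          i       = refl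
≤ᵇ≡not<ᵇ (suc k)       zero    = refl
≤ᵇ≡not<ᵇ (suc zero)    (suc i) = refl
≤ᵇ≡not<ᵇ (suc (suc k)) (suc i) = ≤ᵇ≡not<ᵇ (suc k) i

split-guard : ∀ i k x → x ≡ (if i <ᵇ k then x else 0) + (if k ≤ᵇ i then x else 0)
split-guard i k x rewrite ≤ᵇ≡not<ᵇ k i with i <ᵇ k
... | true  = sym (+-identityʳ x)
... | false = refl

sum-restrict : ∀ {k n} (f : ℕ → ℕ) → k ≤ n → ∑[ i < n ] (if i <ᵇ k then f i else 0) ≡ sumBelow k f
sum-restrict {k} {zero}  f z≤n = refl
sum-restrict {k} {suc n} f k≤1+n with m≤n⇒m<n∨m≡n k≤1+n
... | inj₁ (s≤s k≤n) = begin
  ∑[ i < n ] (if i <ᵇ k then f i else 0) + (if n <ᵇ k then f n else 0)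
    ≡⟨ cong₂ _+_ (sum-restrict f k≤n) (if-false (λ n<k → <⇒≱ (<ᵇ⇒< n k n<k) k≤n)) ⟩
  sumBelow k f + 0 ≡⟨ +-identityʳ _ ⟩
  sumBelow k f ∎
  where open ≡-Reasoning
... | inj₂ refl = sum-cong (suc n) (λ i i<k → if-true (<⇒<ᵇ i<k))

module PrefixCounting
  (n : ℕ) (a : ℕ → ℕ → ℕ)
  (a-sym : ∀ i j → a i j ≡ a j i) (a-irrefl : ∀ i → a i i ≡ 0) (a-≤1 : ∀ i j → a i j ≤ 1)
  where

  deg : ℕ → ℕ
  deg i = ∑[ j < n ] a i j

  -- inside q = 2 · (number of edges among the vertices 0, …, q-1).
  inside : ℕ → ℕ
  inside q = ∑[ j < q ] ∑[ i < q ] a j i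

  back : ℕ → ℕ
  back q = ∑[ j < q ] a q j

  back≤ : ∀ q → back q ≤ q
  back≤ q = ≤-trans (sum-mono q (λ j _ → a-≤1 q j)) (≤-reflexive (trans (sum-const q 1) (*-identityʳ q)))

  back≤deg : ∀ q → q ≤ n → back q ≤ deg q
  back≤deg q q≤n = sum-range-mono (a q) q≤n

  -- Adding vertex q adds its earlier edges, each counted from both ends.
  inside-step : ∀ q → inside (suc q) ≡ inside q + back q + back q
  inside-step q = begin
    ∑[ j < q ] (∑[ i < q ] a j i + a j q) + (back q + a q q)
      ≡⟨ cong₂ _+_ (sum-+ q (λ j → ∑[ i < q ] a j i) (λ j → a j q)) (cong (_+_ (back q)) (a-irrefl q)) ⟩
    inside q + ∑[ j < q ] a j q + (back q + 0)
      ≡⟨ cong₂ (λ x y → inside q + x + y) (sum-cong q (λ j _ → a-sym j q)) (+-identityʳ (back q)) ⟩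
    inside q + back q + back q ∎
    where open ≡-Reasoning

  inside-bound : ∀ q → inside q + q ≤ q * q
  inside-bound zero    = z≤n
  inside-bound (suc q) = begin
    inside (suc q) + suc q            ≡⟨ cong (_+ suc q) (inside-step q) ⟩
    inside q + back q + back q + suc q ≤⟨ +-monoˡ-≤ (suc q) (+-mono-≤ (+-monoʳ-≤ (inside q) (back≤ q)) (back≤ q)) ⟩
    inside q + q + q + suc q          ≤⟨ +-monoˡ-≤ (suc q) (+-monoˡ-≤ q (inside-bound q)) ⟩
    q * q + q + suc q                 ≡⟨ square-step q ⟩
    suc q * suc q                     ∎
    where
    open ≤-Reasoning
    square-step : ∀ q → q * q + q + suc q ≡ suc q * suc q
    square-step = solve-∀

  inside-deficient : ∀ q → back q < q → 2 + inside (suc q) ≤ suc q * q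
  inside-deficient q back<q = begin
    2 + inside (suc q)                 ≡⟨ cong (_+_ 2) (inside-step q) ⟩
    2 + (inside q + back q + back q)   ≡⟨ regroup (inside q) (back q) ⟩
    inside q + suc (back q) + suc (back q) ≤⟨ +-mono-≤ (+-monoʳ-≤ (inside q) back<q) back<q ⟩
    inside q + q + q                   ≤⟨ +-monoˡ-≤ q (inside-bound q) ⟩
    q * q + q                          ≡⟨ +-comm (q * q) q ⟩
    suc q * q                          ∎
    where
    open ≤-Reasoning
    regroup : ∀ t b → 2 + (t + b + b) ≡ t + suc b + suc b
    regroup = solve-∀

  crossing : ℕ → ℕ
  crossing k = ∑[ j < k ] ∑[ i < n ] (if k ≤ᵇ i then a j i else 0)

  prefix-degree-sum : ∀ k → k ≤ n → ∑[ j < k ] deg j ≡ inside k + crossing k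
  prefix-degree-sum k k≤n = begin
    ∑[ j < k ] deg j
      ≡⟨ sum-cong k (λ j _ → sum-cong n (λ i _ → split-guard i k (a j i))) ⟩
    ∑[ j < k ] ∑[ i < n ] ((if i <ᵇ k then a j i else 0) + (if k ≤ᵇ i then a j i else 0))
      ≡⟨ sum-cong k (λ j _ → sum-+ n _ _) ⟩
    ∑[ j < k ] (∑[ i < n ] (if i <ᵇ k then a j i else 0) + ∑[ i < n ] (if k ≤ᵇ i then a j i else 0))
      ≡⟨ sum-+ k _ _ ⟩
    ∑[ j < k ] ∑[ i < n ] (if i <ᵇ k then a j i else 0) + crossing k
      ≡⟨ cong (_+ crossing k) (sum-cong k (λ j _ → sum-restrict (a j) k≤n)) ⟩
    inside k + crossing k ∎
    where open ≡-Reasoning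

  neighbours-in-prefix : ∀ k i → k ≤ n → ∑[ j < k ] a j i ≤ k ⊓ deg i
  neighbours-in-prefix k i k≤n = ⊓-glb
    (≤-trans (sum-mono k (λ j _ → a-≤1 j i)) (≤-reflexive (trans (sum-const k 1) (*-identityʳ k))))
    (≤-trans (≤-reflexive (sum-cong k (λ j _ → a-sym j i))) (sum-range-mono (a i) k≤n))

  crossing-bound : ∀ k → k ≤ n → crossing k ≤ ∑[ i < n ] (if k ≤ᵇ i then k ⊓ deg i else 0)
  crossing-bound k k≤n = begin
    crossing k                                                 ≡⟨ sum-swap k n _ ⟩
    ∑[ i < n ] ∑[ j < k ] (if k ≤ᵇ i then a j i else 0)        ≡⟨ sum-cong n (λ i _ → sum-if k (k ≤ᵇ i) (λ j → a j i)) ⟩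
    ∑[ i < n ] (if k ≤ᵇ i then ∑[ j < k ] a j i else 0)        ≤⟨ sum-mono n (λ i _ → if-≤ (k ≤ᵇ i) (neighbours-in-prefix k i k≤n)) ⟩
    ∑[ i < n ] (if k ≤ᵇ i then k ⊓ deg i else 0)               ∎
    where open ≤-Reasoning

  deficient-prefix : ∀ q → suc q ≤ n → deg q < q →
    2 + ∑[ j < suc q ] deg j ≤ suc q * q + ∑[ i < n ] (if suc q ≤ᵇ i then suc q ⊓ deg i else 0)
  deficient-prefix q q<n deg<q = begin
    2 + ∑[ j < suc q ] deg j                ≡⟨ cong (_+_ 2) (prefix-degree-sum (suc q) q<n) ⟩
    2 + (inside (suc q) + crossing (suc q)) ≡⟨ +-assoc 2 (inside (suc q)) (crossing (suc q)) ⟨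
    2 + inside (suc q) + crossing (suc q)   ≤⟨ +-mono-≤ (inside-deficient q back<q) (crossing-bound (suc q) q<n) ⟩
    suc q * q + ∑[ i < n ] (if suc q ≤ᵇ i then suc q ⊓ deg i else 0) ∎
    where
    open ≤-Reasoning
    back<q : back q < q
    back<q = ≤-<-trans (back≤deg q (<⇒≤ q<n)) deg<q

extend : ∀ n → (Fin n → ℕ) → ℕ → ℕ
extend zero    f i       = 0
extend (suc n) f zero    = f Fin.zero
extend (suc n) f (suc i) = extend n (f ∘ Fin.suc) i

extend-toℕ : ∀ n (f : Fin n → ℕ) u → extend n f (toℕ u) ≡ f u
extend-toℕ (suc n) f Fin.zero    = refl
extend-toℕ (suc n) f (Fin.suc u) = extend-toℕ n (f ∘ Fin.suc) u

extend-fromℕ< : ∀ n (f : Fin n → ℕ) {i} (i<n : i < n) → extend n f i ≡ f (fromℕ< i<n)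
extend-fromℕ< n f i<n = trans (cong (extend n f) (sym (toℕ-fromℕ< i<n))) (extend-toℕ n f (fromℕ< i<n))

extend-out : ∀ n (f : Fin n → ℕ) {i} → n ≤ i → extend n f i ≡ 0
extend-out zero    f         _         = refl
extend-out (suc n) f {suc i} (s≤s n≤i) = extend-out n (f ∘ Fin.suc) n≤i

extend-≤ : ∀ n (f : Fin n → ℕ) {c} → (∀ u → f u ≤ c) → ∀ i → extend n f i ≤ c
extend-≤ zero    f f≤c i       = z≤n
extend-≤ (suc n) f f≤c zero    = f≤c Fin.zero
extend-≤ (suc n) f f≤c (suc i) = extend-≤ n (f ∘ Fin.suc) (f≤c ∘ Fin.suc) i

finSum-extend : ∀ n (f : Fin n → ℕ) → finSum n f ≡ sumBelow n (extend n f)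
finSum-extend n f = trans (cong sum (map-tabulate id f)) (sum-tabulate n f)
  where
  sum-tabulate : ∀ n (f : Fin n → ℕ) → sum (tabulate f) ≡ sumBelow n (extend n f)
  sum-tabulate zero    f = refl
  sum-tabulate (suc n) f = trans (cong (_+_ (f Fin.zero)) (sum-tabulate n (f ∘ Fin.suc)))
                                 (sym (sum-shift n (extend (suc n) f)))

finSum-reindex : ∀ n (f : Fin n → ℕ) (F : ℕ → ℕ) → (∀ u → f u ≡ F (toℕ u)) → finSum n f ≡ sumBelow n F
finSum-reindex n f F f≡F = trans (finSum-extend n f) (sum-cong n (λ i i<n →
  trans (extend-fromℕ< n f i<n) (trans (f≡F (fromℕ< i<n)) (cong F (toℕ-fromℕ< i<n)))))

module AdjacencyMatrix {n : ℕ} (G : SimpleGraph n) where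
  open SimpleGraph G renaming (sym to adj-sym)

  indicator : Bool → ℕ
  indicator b = if b then 1 else 0

  adjMatrix : ℕ → ℕ → ℕ
  adjMatrix i j = extend n (λ u → extend n (λ v → indicator (adj u v)) j) i

  adjMatrix-at : ∀ {i j} (i<n : i < n) (j<n : j < n) → adjMatrix i j ≡ indicator (adj (fromℕ< i<n) (fromℕ< j<n))
  adjMatrix-at i<n j<n = trans (extend-fromℕ< n _ i<n) (extend-fromℕ< n _ j<n)

  adjMatrix-≤1 : ∀ i j → adjMatrix i j ≤ 1
  adjMatrix-≤1 i j = extend-≤ n _ (λ u → extend-≤ n _ (λ v → indicator≤1 (adj u v)) j) i
    where
    indicator≤1 : ∀ b → indicator b ≤ 1
    indicator≤1 true  = ≤-refl
    indicator≤1 false = z≤n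

  adjMatrix-outˡ : ∀ {i} j → n ≤ i → adjMatrix i j ≡ 0
  adjMatrix-outˡ j = extend-out n _

  adjMatrix-outʳ : ∀ i {j} → n ≤ j → adjMatrix i j ≡ 0
  adjMatrix-outʳ i n≤j = n≤0⇒n≡0 (extend-≤ n _ (λ u → ≤-reflexive (extend-out n _ n≤j)) i)

  adjMatrix-sym : ∀ i j → adjMatrix i j ≡ adjMatrix j i
  adjMatrix-sym i j with i <? n | j <? n
  ... | yes i<n | yes j<n = trans (adjMatrix-at i<n j<n)
                              (trans (cong indicator (adj-sym _ _)) (sym (adjMatrix-at j<n i<n)))
  ... | no i≮n  | _       = trans (adjMatrix-outˡ j (≮⇒≥ i≮n)) (sym (adjMatrix-outʳ j (≮⇒≥ i≮n)))
  ... | _       | no j≮n  = trans (adjMatrix-outʳ i (≮⇒≥ j≮n)) (sym (adjMatrix-outˡ i (≮⇒≥ j≮n)))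

  adjMatrix-irrefl : ∀ i → adjMatrix i i ≡ 0
  adjMatrix-irrefl i with i <? n
  ... | yes i<n = trans (adjMatrix-at i<n i<n) (cong indicator (irrefl _))
  ... | no i≮n  = adjMatrix-outˡ i (≮⇒≥ i≮n)

  open PrefixCounting n adjMatrix adjMatrix-sym adjMatrix-irrefl adjMatrix-≤1 public

  degree≡deg : ∀ u → degree G u ≡ deg (toℕ u)
  degree≡deg u = trans (finSum-extend n _)
    (sum-cong n (λ j _ → sym (extend-toℕ n (λ u → extend n (λ v → indicator (adj u v)) j) u)))

beyond-mOf : ∀ n (d : Fin n → ℕ) u → mOf n d ≤ toℕ u → d u < toℕ u
beyond-mOf n d u mOf≤u = ≰⇒> (λ u≤du → 1+n≰n (≤-trans (below-mOf u≤du) mOf≤u))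
  where
  g : Fin n → ℕ
  g u = if toℕ u ≤ᵇ d u then suc (toℕ u) else 0
  ≤-max-tabulate : ∀ {m} (h : Fin m → ℕ) v → h v ≤ foldr _⊔_ 0 (tabulate h)
  ≤-max-tabulate h Fin.zero    = m≤m⊔n _ _
  ≤-max-tabulate h (Fin.suc v) = ≤-trans (≤-max-tabulate (h ∘ Fin.suc) v) (m≤n⊔m _ _)
  below-mOf : toℕ u ≤ d u → suc (toℕ u) ≤ mOf n d
  below-mOf u≤du = begin
    suc (toℕ u)                ≡⟨ if-true (≤⇒≤ᵇ u≤du) ⟨
    g u                        ≤⟨ ≤-max-tabulate g u ⟩
    foldr _⊔_ 0 (tabulate g)   ≡⟨ cong (foldr _⊔_ 0) (map-tabulate id g) ⟨
    mOf n d                    ∎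
    where open ≤-Reasoning

+≤-minus : ∀ c {x y} → c + y ≤ x → + c ≤ℤ + x ℤ.- + y
+≤-minus c {x} {y} c+y≤x = subst (+ c ≤ℤ_) x-y≡x∸y (ℤ.+≤+ (m+n≤o⇒m≤o∸n c c+y≤x))
  where
  x-y≡x∸y : + (x ∸ y) ≡ + x ℤ.- + y
  x-y≡x∸y = sym (trans (ℤ.m-n≡m⊖n x y) (ℤ.⊖-≥ (≤-trans (m≤n+m y c) c+y≤x)))

corollary3p6 : (n : ℕ) (d : Fin n → ℕ) → IsDegreeSequence n d → NonIncreasing n d →
    (k : ℕ) → 1 ≤ k → k ≤ n → mOf n d < k → (+ 2) ≤ℤ Δ n d k
corollary3p6 n d (G , d≡degree) _ (suc q) _ k≤n mOf<k =
  +≤-minus 2 (subst₂ (λ y x → 2 + y ≤ suc q * q + x) (sym prefix-sum) (sym tail-sum)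
                     (deficient-prefix q k≤n deg<q))
  where
  open AdjacencyMatrix G
  d≡deg : ∀ u → d u ≡ deg (toℕ u)
  d≡deg u = trans (sym (d≡degree u)) (degree≡deg u)
  last : Fin n
  last = fromℕ< k≤n
  deg<q : deg q < q
  deg<q = subst₂ _<_ (trans (d≡deg last) (cong deg (toℕ-fromℕ< k≤n))) (toℕ-fromℕ< k≤n)
            (beyond-mOf n d last (subst (mOf n d ≤_) (sym (toℕ-fromℕ< k≤n)) (≤-pred mOf<k)))
  prefix-sum : finSum n (λ u → if toℕ u <ᵇ suc q then d u else 0) ≡ ∑[ j < suc q ] deg j
  prefix-sum = trans (finSum-reindex n _ _ (λ u → cong (λ x → if toℕ u <ᵇ suc q then x else 0) (d≡deg u)))
                     (sum-restrict deg k≤n)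
  tail-sum : finSum n (λ u → if suc q ≤ᵇ toℕ u then suc q ⊓ d u else 0)
             ≡ ∑[ i < n ] (if suc q ≤ᵇ i then suc q ⊓ deg i else 0)
  tail-sum = finSum-reindex n _ _ (λ u → cong (λ x → if suc q ≤ᵇ toℕ u then suc q ⊓ x else 0) (d≡deg u))
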